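{- Let $s$ and $n$ be positive integers, let $x_1,\dots,x_n$ be independent variables, and write $M_k^{(s)}(n)=M_k^{(s)}(x_1,\dots,x_n)$ and $M_k^{(s)}(n-1)=M_k^{(s)}(x_1,\dots,x_{n-1})$. Then for $k\geq s+1$, \[ M_{k}^{(s)}(n)=\sum_{\substack{0\leq j\leq k\\ j\equiv 0 \text{ or } 1 \pmod{s+1}}}x_{n}^{j}\,M_{k-j}^{(s)}(n-1), \] and \[ M_{k}^{(s)}(n)=x_{n}^{s+1}M_{k-s-1}^{(s)}(n)+x_{n}M_{k-1}^{(s)}(n-1)+M_{k}^{(s)}(n-1). \]
   Context: For integers $s\ge 1$, $m\ge 0$, $k\ge 0$, the modular symmetric function is \[ M_{k}^{(s)}(x_{1},\ldots,x_{m})=\sum x_{1}^{a_{1}}\cdots x_{m}^{a_{m}}, \] where the sum runs over all $m$-tuples $(a_1,\dots,a_m)$ of nonnegative integers with $a_1+\cdots+a_m=k$ and each $a_i\equiv 0$ or $a_i\equiv 1 \pmod{s+1}$. For zero variables ($m=0$), $M_k^{(s)}()=\delta_{k,0}$ (Kronecker delta). -}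

module Defs where

open import Level using (Level)
open import Algebra.Bundles using (CommutativeRing)
open import Data.Nat using (ℕ; zero; suc; _%_; _≟_)
open import Data.List using (List; []; _∷_; [_]; map; concatMap; upTo; filter; foldr)
open import Data.Vec using (Vec; []; _∷_; sum)
open import Data.Vec.Relation.Unary.All using (All; all?)
open import Data.Sum using (_⊎_)
open import Data.Product using (_×_)
open import Relation.Binary.PropositionalEquality using (_≡_)
open import Relation.Nullary.Decidable using (Dec; _⊎-dec_; _×-dec_)

Admissible : ℕ → ℕ → Set
Admissible s a = (a % suc s ≡ 0) ⊎ (a % suc s ≡ 1)

admissible? : (s a : ℕ) → Dec (Admissible s a)
admissible? s a = (a % suc s ≟ 0) ⊎-dec (a % suc s ≟ 1)

boxes : (m b : ℕ) → List (Vec ℕ m)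
boxes zero b = [ [] ]
boxes (suc m) b = concatMap (λ a → map (a ∷_) (boxes m b)) (upTo (suc b))

Exponent : (s k : ℕ) {m : ℕ} → Vec ℕ m → Set
Exponent s k v = (sum v ≡ k) × All (Admissible s) v

exponents : (s k m : ℕ) → List (Vec ℕ m)
exponents s k m = filter (λ v → (sum v ≟ k) ×-dec all? (admissible? s) v) (boxes m k)

module ModSym {c ℓ : Level} (R : CommutativeRing c ℓ) where
  open CommutativeRing R

  pow : Carrier → ℕ → Carrier
  pow x zero = 1#
  pow x (suc n) = x * pow x n

  monomial : {m : ℕ} → Vec Carrier m → Vec ℕ m → Carrier
  monomial [] [] = 1#
  monomial (x ∷ xs) (a ∷ as) = pow x a * monomial xs as

  Σ : List Carrier → Carrier
  Σ = foldr _+_ 0#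

  M : (s k : ℕ) {m : ℕ} → Vec Carrier m → Carrier
  M s k {m} xs = Σ (map (monomial xs) (exponents s k m))

-- Peeling off one variable x gives M_k(x, xs) = Σ_{admissible a ≤ k} x^a M_{k-a}(xs): a convolution of
-- M_•(xs) against the admissible powers of x. Two such convolutions (in x and in y) commute, since both
-- are sums over admissible pairs (a, b) with a + b ≤ k; by induction on the variables this turns the
-- expansion in the first variable into the expansion in the last one. For the recurrence, split the
-- admissible exponents j ≤ k into 0, 1 and the shifts s + 1 + i of the admissible i ≤ k - s - 1: there is
-- no admissible exponent strictly between 1 and s + 1, and admissibility is (s + 1)-periodic.
module Submission where

open import Defs
open import Level using (Level)
open import Algebra.Bundles using (CommutativeRing)
open import Data.Nat using (ℕ; suc; _≤_; _∸_)
open import Data.List using (map; filter; upTo)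
open import Data.Vec using (Vec; _∷ʳ_)
open import Data.Product using (_×_)

open import Data.Nat as ℕ using (zero; _<_; _≤′_; z≤n; s≤s; _%_; _≤?_)
open import Data.Nat.Properties as ℕₚ
  using (≤-refl; ≤-trans; ≤-pred; <⇒≱; ≤⇒≤′; ≤′⇒≤; m≤m+n; m∸n≤m; m+n∸m≡n; m+[n∸m]≡n; +-suc;
         ∸-+-assoc; [m+n]∸[m+o]≡n∸o; m+n≤o⇒m≤o∸n; m≤o∸n⇒m+n≤o; m≤n⇒∃[o]m+o≡n)
open import Data.Nat.DivMod using (m<n⇒m%n≡m; [m+n]%n≡m%n)
open import Data.List using (List; []; _∷_; _++_; concatMap; applyUpTo)
open import Data.List.Properties using (map-∘; map-applyUpTo; map-upTo; upTo-∷ʳ)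
open import Data.List.Membership.Propositional using (_∈_)
open import Data.List.Membership.Propositional.Properties using (∈-upTo⁻; ∈-applyUpTo⁻)
open import Data.List.Relation.Unary.Any using (here; there)
open import Data.Vec using ([]; _∷_; sum)
open import Data.Vec.Relation.Unary.All using (_∷_; all?)
open import Data.Product using (_,_; proj₁; proj₂)
open import Data.Sum using (inj₁; inj₂)
import Data.Sum as Sum
open import Function using (_∘_; case_of_)
open import Function.Bundles using (_⇔_; mk⇔; Equivalence)
open import Relation.Nullary using (Dec; yes; no; ¬_; contradiction)
open import Relation.Nullary.Decidable using (_×-dec_)
open import Relation.Unary using (Pred; Decidable)
open import Relation.Binary.PropositionalEquality as ≡ using (_≡_; cong)

applyUpTo-+ : ∀ {a} {A : Set a} (f : ℕ → A) m n →
              applyUpTo f (m ℕ.+ n) ≡ applyUpTo f m ++ applyUpTo (f ∘ (m ℕ.+_)) n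
applyUpTo-+ f zero    n = ≡.refl
applyUpTo-+ f (suc m) n = cong (f 0 ∷_) (applyUpTo-+ (f ∘ suc) m n)

module ListSums {c ℓ : Level} (R : CommutativeRing c ℓ) where
  open CommutativeRing R
  open ModSym R using (Σ; pow)
  open import Relation.Binary.Reasoning.Setoid setoid

  when : ∀ {p} {P : Set p} → Dec P → Carrier → Carrier
  when (yes _) x = x
  when (no _)  _ = 0#

  module _ {p q} {P : Set p} {Q : Set q} where

    when-cong : P ⇔ Q → (p? : Dec P) (q? : Dec Q) → ∀ {x y} → x ≈ y → when p? x ≈ when q? y
    when-cong P⇔Q (yes _) (yes _) x≈y = x≈y
    when-cong P⇔Q (yes p) (no ¬q) _   = contradiction (Equivalence.to P⇔Q p) ¬q
    when-cong P⇔Q (no ¬p) (yes q) _   = contradiction (Equivalence.from P⇔Q q) ¬p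
    when-cong P⇔Q (no _)  (no _)  _   = refl

    when-× : (p? : Dec P) (q? : Dec Q) → ∀ x → when p? (when q? x) ≈ when (p? ×-dec q?) x
    when-× (yes _) (yes _) x = refl
    when-× (yes _) (no _)  x = refl
    when-× (no _)  _       x = refl

  module _ {p} {P : Set p} where

    when-congʳ : (p? : Dec P) → ∀ {x y} → x ≈ y → when p? x ≈ when p? y
    when-congʳ (yes _) x≈y = x≈y
    when-congʳ (no _)  _   = refl

    when-yes : (p? : Dec P) → P → ∀ x → when p? x ≈ x
    when-yes (yes _) _ x = refl
    when-yes (no ¬p) p x = contradiction p ¬p

    when-no : (p? : Dec P) → ¬ P → ∀ x → when p? x ≈ 0#
    when-no (yes p) ¬p x = contradiction p ¬p
    when-no (no _)  _  x = refl

    *-when : (p? : Dec P) → ∀ y x → y * when p? x ≈ when p? (y * x)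
    *-when (yes _) y x = refl
    *-when (no _)  y x = zeroʳ y

  module _ {a} {A : Set a} where

    Σ-cong : {f g : A → Carrier} (L : List A) → (∀ x → f x ≈ g x) → Σ (map f L) ≈ Σ (map g L)
    Σ-cong []      f≈g = refl
    Σ-cong (x ∷ L) f≈g = +-cong (f≈g x) (Σ-cong L f≈g)

    Σ-cong-∈ : {f g : A → Carrier} (L : List A) → (∀ x → x ∈ L → f x ≈ g x) → Σ (map f L) ≈ Σ (map g L)
    Σ-cong-∈ []      f≈g = refl
    Σ-cong-∈ (x ∷ L) f≈g = +-cong (f≈g x (here ≡.refl)) (Σ-cong-∈ L (λ y y∈L → f≈g y (there y∈L)))

    Σ-zero : {f : A → Carrier} (L : List A) → (∀ x → x ∈ L → f x ≈ 0#) → Σ (map f L) ≈ 0#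
    Σ-zero []      f≈0 = refl
    Σ-zero (x ∷ L) f≈0 =
      trans (+-cong (f≈0 x (here ≡.refl)) (Σ-zero L (λ y y∈L → f≈0 y (there y∈L)))) (+-identityˡ 0#)

    Σ-++ : (f : A → Carrier) (L L′ : List A) → Σ (map f (L ++ L′)) ≈ Σ (map f L) + Σ (map f L′)
    Σ-++ f []      L′ = sym (+-identityˡ _)
    Σ-++ f (x ∷ L) L′ = trans (+-congˡ (Σ-++ f L L′)) (sym (+-assoc _ _ _))

    Σ-+ : (f g : A → Carrier) (L : List A) → Σ (map (λ x → f x + g x) L) ≈ Σ (map f L) + Σ (map g L)
    Σ-+ f g []      = sym (+-identityˡ 0#)
    Σ-+ f g (x ∷ L) = begin
      (f x + g x) + Σ (map (λ x → f x + g x) L) ≈⟨ +-congˡ (Σ-+ f g L) ⟩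
      (f x + g x) + (Σ (map f L) + Σ (map g L)) ≈⟨ +-assoc _ _ _ ⟩
      f x + (g x + (Σ (map f L) + Σ (map g L))) ≈⟨ +-congˡ (x∙yz≈y∙xz (g x) _ _) ⟩
      f x + (Σ (map f L) + (g x + Σ (map g L))) ≈⟨ sym (+-assoc _ _ _) ⟩
      (f x + Σ (map f L)) + (g x + Σ (map g L)) ∎
      where open import Algebra.Properties.CommutativeSemigroup +-commutativeSemigroup using (x∙yz≈y∙xz)

    *-Σ : ∀ y (f : A → Carrier) (L : List A) → y * Σ (map f L) ≈ Σ (map (λ x → y * f x) L)
    *-Σ y f []      = zeroʳ y
    *-Σ y f (x ∷ L) = trans (distribˡ y _ _) (+-congˡ (*-Σ y f L))

    Σ-filter : ∀ {p} {P : Pred A p} (P? : Decidable P) (f : A → Carrier) (L : List A) →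
               Σ (map f (filter P? L)) ≈ Σ (map (λ x → when (P? x) (f x)) L)
    Σ-filter P? f []      = refl
    Σ-filter P? f (x ∷ L) with P? x
    ... | yes _ = +-congˡ (Σ-filter P? f L)
    ... | no _  = trans (Σ-filter P? f L) (sym (+-identityˡ _))

    when-*-Σ : ∀ {p q} {P : Set p} {Q : Pred A q} (p? : Dec P) (q? : Decidable Q) y (f : A → Carrier) L →
               when p? (y * Σ (map (λ x → when (q? x) (f x)) L))
                 ≈ Σ (map (λ x → when (p? ×-dec q? x) (y * f x)) L)
    when-*-Σ (no _)      q? y f L = sym (Σ-zero L (λ _ _ → refl))
    when-*-Σ p?@(yes _) q? y f L =
      trans (*-Σ y _ L) (Σ-cong L (λ x → trans (*-when (q? x) y (f x)) (when-× p? (q? x) (y * f x))))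

  Σ-concatMap : ∀ {a b} {A : Set a} {B : Set b} (f : B → Carrier) (g : A → List B) (L : List A) →
                Σ (map f (concatMap g L)) ≈ Σ (map (λ x → Σ (map f (g x))) L)
  Σ-concatMap f g []      = refl
  Σ-concatMap f g (x ∷ L) = trans (Σ-++ f (g x) (concatMap g L)) (+-congˡ (Σ-concatMap f g L))

  Σ-swap : ∀ {a b} {A : Set a} {B : Set b} (f : A → B → Carrier) (L : List A) (L′ : List B) →
           Σ (map (λ x → Σ (map (f x) L′)) L) ≈ Σ (map (λ y → Σ (map (λ x → f x y) L)) L′)
  Σ-swap f []      L′ = sym (Σ-zero L′ (λ _ _ → refl))
  Σ-swap f (x ∷ L) L′ = trans (+-congˡ (Σ-swap f L L′)) (sym (Σ-+ (f x) _ L′))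

  Σ-upTo-vanishing : (f : ℕ → Carrier) {j n : ℕ} → j ≤ n → (∀ a → j < a → f a ≈ 0#) →
                     Σ (map f (upTo (suc n))) ≈ Σ (map f (upTo (suc j)))
  Σ-upTo-vanishing f {j} j≤n f≈0 = go (≤⇒≤′ j≤n)
    where
    go : ∀ {n} → j ≤′ n → Σ (map f (upTo (suc n))) ≈ Σ (map f (upTo (suc j)))
    go ℕ.≤′-refl = refl
    go {suc n} (ℕ.≤′-step j≤′n) = begin
      Σ (map f (upTo (suc (suc n))))              ≡⟨ cong (Σ ∘ map f) (≡.sym (upTo-∷ʳ (suc n))) ⟩
      Σ (map f (upTo (suc n) ++ suc n ∷ []))       ≈⟨ Σ-++ f (upTo (suc n)) (suc n ∷ []) ⟩
      Σ (map f (upTo (suc n))) + (f (suc n) + 0#)  ≈⟨ +-congˡ (+-identityʳ _) ⟩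
      Σ (map f (upTo (suc n))) + f (suc n)         ≈⟨ +-congˡ (f≈0 (suc n) (s≤s (≤′⇒≤ j≤′n))) ⟩
      Σ (map f (upTo (suc n))) + 0#                ≈⟨ +-identityʳ _ ⟩
      Σ (map f (upTo (suc n)))                     ≈⟨ go j≤′n ⟩
      Σ (map f (upTo (suc j)))                     ∎

  pow-+ : ∀ x a b → pow x (a ℕ.+ b) ≈ pow x a * pow x b
  pow-+ x zero    b = sym (*-identityˡ _)
  pow-+ x (suc a) b = trans (*-congˡ (pow-+ x a b)) (sym (*-assoc _ _ _))

module Convolution {c ℓ : Level} (R : CommutativeRing c ℓ) (s : ℕ) where
  open CommutativeRing R
  open ModSym R using (Σ; pow)
  open ListSums R
  open import Relation.Binary.Reasoning.Setoid setoid

  -- Written exactly as the right-hand side of the first identity, which is therefore M-∷ʳ.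
  conv : (ℕ → Carrier) → Carrier → ℕ → Carrier
  conv F x k = Σ (map (λ j → pow x j * F (k ∸ j)) (filter (admissible? s) (upTo (suc k))))

  conv-cong : ∀ {F G} x k → (∀ j → F j ≈ G j) → conv F x k ≈ conv G x k
  conv-cong x k F≈G = Σ-cong (filter (admissible? s) (upTo (suc k))) (λ j → *-congˡ (F≈G (k ∸ j)))

  admissible≤? : (k a : ℕ) → Dec (Admissible s a × a ≤ k)
  admissible≤? k a = admissible? s a ×-dec a ≤? k

  conv-bounded : ∀ F x {k n} → k ≤ n →
                 conv F x k ≈ Σ (map (λ a → when (admissible≤? k a) (pow x a * F (k ∸ a))) (upTo (suc n)))
  conv-bounded F x {k} {n} k≤n = begin
    conv F x k
      ≈⟨ Σ-filter (admissible? s) term (upTo (suc k)) ⟩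
    Σ (map (λ a → when (admissible? s a) (term a)) (upTo (suc k)))
      ≈⟨ Σ-cong-∈ (upTo (suc k)) (λ a a∈ → when-cong (mk⇔ (_, ≤-pred (∈-upTo⁻ a∈)) proj₁)
                                                      (admissible? s a) (admissible≤? k a) refl) ⟩
    Σ (map bounded (upTo (suc k)))
      ≈⟨ Σ-upTo-vanishing bounded k≤n (λ a k<a → when-no (admissible≤? k a) (<⇒≱ k<a ∘ proj₂) (term a)) ⟨
    Σ (map bounded (upTo (suc n))) ∎
    where
    term : ℕ → Carrier
    term a = pow x a * F (k ∸ a)
    bounded : ℕ → Carrier
    bounded a = when (admissible≤? k a) (term a)

  admissiblePair? : (k a b : ℕ) → Dec ((Admissible s a × Admissible s b) × a ℕ.+ b ≤ k)
  admissiblePair? k a b = (admissible? s a ×-dec admissible? s b) ×-dec a ℕ.+ b ≤? k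

  pairTerm : (ℕ → Carrier) → Carrier → Carrier → ℕ → ℕ → ℕ → Carrier
  pairTerm F x y k a b = when (admissiblePair? k a b) (pow x a * (pow y b * F (k ∸ (a ℕ.+ b))))

  conv-conv : ∀ F x y k →
              conv (conv F y) x k ≈ Σ (map (λ a → Σ (map (pairTerm F x y k a) (upTo (suc k)))) (upTo (suc k)))
  conv-conv F x y k = begin
    conv (conv F y) x k
      ≈⟨ conv-bounded (conv F y) x ≤-refl ⟩
    Σ (map (λ a → when (admissible≤? k a) (pow x a * conv F y (k ∸ a))) U)
      ≈⟨ Σ-cong U (λ a → when-congʳ (admissible≤? k a) (*-congˡ (conv-bounded F y (m∸n≤m k a)))) ⟩
    Σ (map (λ a → when (admissible≤? k a) (pow x a * Σ (map (λ b → when (admissible≤? (k ∸ a) b) (inner a b)) U))) U)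
      ≈⟨ Σ-cong U (λ a → when-*-Σ (admissible≤? k a) (admissible≤? (k ∸ a)) (pow x a) (inner a) U) ⟩
    Σ (map (λ a → Σ (map (λ b → when (admissible≤? k a ×-dec admissible≤? (k ∸ a) b) (pow x a * inner a b)) U)) U)
      ≈⟨ Σ-cong U (λ a → Σ-cong U (λ b → when-cong pair⇔ (admissible≤? k a ×-dec admissible≤? (k ∸ a) b)
                                                    (admissiblePair? k a b)
                                                    (*-congˡ (*-congˡ (reflexive (cong F (∸-+-assoc k a b))))))) ⟩
    Σ (map (λ a → Σ (map (pairTerm F x y k a) U)) U) ∎
    where
    U = upTo (suc k)
    inner : ℕ → ℕ → Carrier
    inner a b = pow y b * F (k ∸ a ∸ b)
    pair⇔ : ∀ {a b} → ((Admissible s a × a ≤ k) × (Admissible s b × b ≤ k ∸ a))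
                      ⇔ ((Admissible s a × Admissible s b) × a ℕ.+ b ≤ k)
    pair⇔ {a} {b} = mk⇔
      (λ ((αa , a≤k) , (αb , b≤k∸a)) →
         (αa , αb) , ≡.subst (_≤ k) (ℕₚ.+-comm b a) (m≤o∸n⇒m+n≤o b a≤k b≤k∸a))
      (λ ((αa , αb) , a+b≤k) →
         (αa , ≤-trans (m≤m+n a b) a+b≤k) , (αb , m+n≤o⇒m≤o∸n b (≡.subst (_≤ k) (ℕₚ.+-comm a b) a+b≤k)))

  pairTerm-swap : ∀ F x y k a b → pairTerm F x y k a b ≈ pairTerm F y x k b a
  pairTerm-swap F x y k a b =
    when-cong (mk⇔ (swap {a} {b}) (swap {b} {a})) (admissiblePair? k a b) (admissiblePair? k b a)
      (trans (x∙yz≈y∙xz (pow x a) (pow y b) _)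
             (*-congˡ (*-congˡ (reflexive (cong (λ n → F (k ∸ n)) (ℕₚ.+-comm a b))))))
    where
    open import Algebra.Properties.CommutativeSemigroup *-commutativeSemigroup using (x∙yz≈y∙xz)
    swap : ∀ {a b} → (Admissible s a × Admissible s b) × a ℕ.+ b ≤ k
                   → (Admissible s b × Admissible s a) × b ℕ.+ a ≤ k
    swap {a} {b} ((αa , αb) , a+b≤k) = (αb , αa) , ≡.subst (_≤ k) (ℕₚ.+-comm a b) a+b≤k

  conv-comm : ∀ F x y k → conv (conv F y) x k ≈ conv (conv F x) y k
  conv-comm F x y k = begin
    conv (conv F y) x k                                      ≈⟨ conv-conv F x y k ⟩
    Σ (map (λ a → Σ (map (pairTerm F x y k a) U)) U)          ≈⟨ Σ-swap (pairTerm F x y k) U U ⟩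
    Σ (map (λ b → Σ (map (λ a → pairTerm F x y k a b) U)) U)
      ≈⟨ Σ-cong U (λ b → Σ-cong U (λ a → pairTerm-swap F x y k a b)) ⟩
    Σ (map (λ b → Σ (map (pairTerm F y x k b) U)) U)          ≈⟨ conv-conv F y x k ⟨
    conv (conv F x) y k                                      ∎
    where
    U = upTo (suc k)

  admissible-mod : ∀ {a b} → a % suc s ≡ b % suc s → Admissible s a → Admissible s b
  admissible-mod a≡b = Sum.map (≡.trans (≡.sym a≡b)) (≡.trans (≡.sym a≡b))

  admissible-periodic : ∀ i → Admissible s (suc s ℕ.+ i) ⇔ Admissible s i
  admissible-periodic i =
    mk⇔ (admissible-mod {suc s ℕ.+ i} {i} period) (admissible-mod {i} {suc s ℕ.+ i} (≡.sym period))
    where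
    period : (suc s ℕ.+ i) % suc s ≡ i % suc s
    period = ≡.trans (cong (_% suc s) (ℕₚ.+-comm (suc s) i)) ([m+n]%n≡m%n i (suc s))

  inadmissible-between : ∀ {j} → 2 ≤ j → j ≤ s → ¬ Admissible s j
  inadmissible-between {j} 2≤j j≤s adm with ≡.subst (λ r → r ≡ 0 Sum.⊎ r ≡ 1) (m<n⇒m%n≡m (s≤s j≤s)) adm
  inadmissible-between (s≤s (s≤s _)) _ _ | inj₁ ()
  inadmissible-between (s≤s (s≤s _)) _ _ | inj₂ ()

  upTo-split : 1 ≤ s → ∀ r →
               upTo (suc (suc s ℕ.+ r)) ≡ 0 ∷ 1 ∷ applyUpTo (2 ℕ.+_) (s ∸ 1) ++ applyUpTo (suc s ℕ.+_) (suc r)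
  upTo-split 1≤s r = ≡.trans (cong upTo (≡.sym (+-suc (suc s) r)))
                    (≡.trans (applyUpTo-+ (λ j → j) (suc s) (suc r))
                             (cong (λ n → upTo (suc n) ++ applyUpTo (suc s ℕ.+_) (suc r)) (≡.sym (m+[n∸m]≡n 1≤s))))

  Σ-inadmissible-between : 1 ≤ s → (f : ℕ → Carrier) →
                           Σ (map (λ j → when (admissible? s j) (f j)) (applyUpTo (2 ℕ.+_) (s ∸ 1))) ≈ 0#
  Σ-inadmissible-between 1≤s f = Σ-zero (applyUpTo (2 ℕ.+_) (s ∸ 1)) λ j j∈ →
    case ∈-applyUpTo⁻ (2 ℕ.+_) j∈ of λ where
      (i , i<s∸1 , ≡.refl) → when-no (admissible? s j) (inadmissible-between (s≤s (s≤s z≤n)) (2+i≤s i<s∸1)) (f j)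
    where
    2+i≤s : ∀ {i} → i < s ∸ 1 → 2 ℕ.+ i ≤ s
    2+i≤s i<s∸1 = ≡.subst (_ ≤_) (m+[n∸m]≡n 1≤s) (s≤s i<s∸1)

  Σ-shifted : ∀ F x r →
              Σ (map (λ j → when (admissible? s j) (pow x j * F (suc s ℕ.+ r ∸ j))) (applyUpTo (suc s ℕ.+_) (suc r)))
                ≈ pow x (suc s) * conv F x r
  Σ-shifted F x r = begin
    Σ (map g (applyUpTo (suc s ℕ.+_) (suc r)))
      ≡⟨ cong Σ (≡.trans (map-applyUpTo (suc s ℕ.+_) g (suc r)) (≡.sym (map-upTo _ (suc r)))) ⟩
    Σ (map (g ∘ (suc s ℕ.+_)) (upTo (suc r)))
      ≈⟨ Σ-cong (upTo (suc r)) shift ⟩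
    Σ (map (λ i → pow x (suc s) * when (admissible? s i) (term i)) (upTo (suc r)))
      ≈⟨ *-Σ (pow x (suc s)) _ (upTo (suc r)) ⟨
    pow x (suc s) * Σ (map (λ i → when (admissible? s i) (term i)) (upTo (suc r)))
      ≈⟨ *-congˡ (Σ-filter (admissible? s) term (upTo (suc r))) ⟨
    pow x (suc s) * conv F x r ∎
    where
    g : ℕ → Carrier
    g j = when (admissible? s j) (pow x j * F (suc s ℕ.+ r ∸ j))
    term : ℕ → Carrier
    term i = pow x i * F (r ∸ i)
    shift : ∀ i → g (suc s ℕ.+ i) ≈ pow x (suc s) * when (admissible? s i) (term i)
    shift i = trans
      (when-cong (admissible-periodic i) (admissible? s (suc s ℕ.+ i)) (admissible? s i)
        (trans (*-cong (pow-+ x (suc s) i) (reflexive (cong F ([m+n]∸[m+o]≡n∸o (suc s) r i)))) (*-assoc _ _ _)))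
      (sym (*-when (admissible? s i) (pow x (suc s)) (term i)))

  conv-recurrence : 1 ≤ s → ∀ F x {k} → suc s ≤ k →
                    conv F x k ≈ pow x (suc s) * conv F x (k ∸ suc s) + x * F (k ∸ 1) + F k
  conv-recurrence 1≤s F x s<k with m≤n⇒∃[o]m+o≡n s<k
  ... | r , ≡.refl = begin
    conv F x k
      ≈⟨ Σ-filter (admissible? s) term (upTo (suc k)) ⟩
    Σ (map g (upTo (suc k)))
      ≡⟨ cong (Σ ∘ map g) (upTo-split 1≤s r) ⟩
    g 0 + (g 1 + Σ (map g (between ++ high)))
      ≈⟨ +-congˡ (+-congˡ (Σ-++ g between high)) ⟩
    g 0 + (g 1 + (Σ (map g between) + Σ (map g high)))
      ≈⟨ +-cong g0 (+-cong g1 (trans (+-cong (Σ-inadmissible-between 1≤s term) (Σ-shifted F x r)) (+-identityˡ _))) ⟩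
    F k + (x * F (k ∸ 1) + pow x (suc s) * conv F x r)
      ≈⟨ trans (+-comm _ _) (+-congʳ (+-comm _ _)) ⟩
    pow x (suc s) * conv F x r + x * F (k ∸ 1) + F k
      ≡⟨ cong (λ n → pow x (suc s) * conv F x n + x * F (k ∸ 1) + F k) (≡.sym (m+n∸m≡n (suc s) r)) ⟩
    pow x (suc s) * conv F x (k ∸ suc s) + x * F (k ∸ 1) + F k ∎
    where
    k = suc s ℕ.+ r
    between = applyUpTo (2 ℕ.+_) (s ∸ 1)
    high = applyUpTo (suc s ℕ.+_) (suc r)
    term : ℕ → Carrier
    term j = pow x j * F (k ∸ j)
    g : ℕ → Carrier
    g j = when (admissible? s j) (term j)
    g0 : g 0 ≈ F k
    g0 = trans (when-yes (admissible? s 0) (inj₁ ≡.refl) (term 0)) (*-identityˡ (F k))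
    g1 : g 1 ≈ x * F (k ∸ 1)
    g1 = trans (when-yes (admissible? s 1) (inj₂ (m<n⇒m%n≡m (s≤s 1≤s))) (term 1)) (*-congʳ (*-identityʳ x))

module Expansion {c ℓ : Level} (R : CommutativeRing c ℓ) (s : ℕ) where
  open CommutativeRing R
  open ModSym R
  open ListSums R
  open Convolution R s
  open import Relation.Binary.Reasoning.Setoid setoid

  exponent? : (k : ℕ) {m : ℕ} (v : Vec ℕ m) → Dec (Exponent s k v)
  exponent? k v = (sum v ℕ.≟ k) ×-dec all? (admissible? s) v

  -- M s k xs is boxSum k k xs; expanding its first variable leaves a degree k - a in a box of side k.
  boxSum : ℕ → ℕ → {m : ℕ} → Vec Carrier m → Carrier
  boxSum b k {m} xs = Σ (map (monomial xs) (filter (exponent? k) (boxes m b)))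

  exponent-∷ : ∀ {k a m} {v : Vec ℕ m} →
               Exponent s k (a ∷ v) ⇔ ((Admissible s a × a ≤ k) × Exponent s (k ∸ a) v)
  exponent-∷ {k} {a} {v = v} = mk⇔
    (λ where (a+v≡k , αa ∷ αv) → (αa , ≡.subst (a ≤_) a+v≡k (m≤m+n a (sum v)))
                               , (≡.trans (≡.sym (m+n∸m≡n a (sum v))) (cong (_∸ a) a+v≡k) , αv))
    (λ ((αa , a≤k) , (v≡k∸a , αv)) → ≡.trans (cong (a ℕ.+_) v≡k∸a) (m+[n∸m]≡n a≤k) , αa ∷ αv)

  boxSum-∷ : ∀ b k {m} x (xs : Vec Carrier m) →
             boxSum b k (x ∷ xs)
               ≈ Σ (map (λ a → when (admissible≤? k a) (pow x a * boxSum b (k ∸ a) xs)) (upTo (suc b)))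
  boxSum-∷ b k {m} x xs = begin
    boxSum b k (x ∷ xs)                  ≈⟨ Σ-filter (exponent? k) (monomial (x ∷ xs)) (concatMap row U) ⟩
    Σ (map f (concatMap row U))          ≈⟨ Σ-concatMap f row U ⟩
    Σ (map (λ a → Σ (map f (row a))) U)  ≈⟨ Σ-cong U (λ a → reflexive (cong Σ (≡.sym (map-∘ B)))) ⟩
    Σ (map (λ a → Σ (map (λ w → when (exponent? k (a ∷ w)) (pow x a * monomial xs w)) B)) U)
      ≈⟨ Σ-cong U (λ a → Σ-cong B (λ w → when-cong exponent-∷ (exponent? k (a ∷ w))
                                                  (admissible≤? k a ×-dec exponent? (k ∸ a) w) refl)) ⟩
    Σ (map (λ a → Σ (map (λ w → when (admissible≤? k a ×-dec exponent? (k ∸ a) w) (pow x a * monomial xs w)) B)) U)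
      ≈⟨ Σ-cong U (λ a → when-*-Σ (admissible≤? k a) (exponent? (k ∸ a)) (pow x a) (monomial xs) B) ⟨
    Σ (map (λ a → when (admissible≤? k a) (pow x a * Σ (map (λ w → when (exponent? (k ∸ a) w) (monomial xs w)) B))) U)
      ≈⟨ Σ-cong U (λ a → when-congʳ (admissible≤? k a) (*-congˡ (Σ-filter (exponent? (k ∸ a)) (monomial xs) B))) ⟨
    Σ (map (λ a → when (admissible≤? k a) (pow x a * boxSum b (k ∸ a) xs)) U) ∎
    where
    U = upTo (suc b)
    B = boxes m b
    row : ℕ → List (Vec ℕ (suc m))
    row a = map (a ∷_) B
    f : Vec ℕ (suc m) → Carrier
    f v = when (exponent? k v) (monomial (x ∷ xs) v)

  boxSum-∷-conv : ∀ {b k m} x (xs : Vec Carrier m) → k ≤ b →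
                  (∀ {j} → j ≤ b → boxSum b j xs ≈ M s j xs) →
                  boxSum b k (x ∷ xs) ≈ conv (λ j → M s j xs) x k
  boxSum-∷-conv {b} {k} x xs k≤b tail≈M = begin
    boxSum b k (x ∷ xs)
      ≈⟨ boxSum-∷ b k x xs ⟩
    Σ (map (λ a → when (admissible≤? k a) (pow x a * boxSum b (k ∸ a) xs)) (upTo (suc b)))
      ≈⟨ Σ-cong (upTo (suc b)) (λ a → when-congʳ (admissible≤? k a)
                                        (*-congˡ (tail≈M (≤-trans (m∸n≤m k a) k≤b)))) ⟩
    Σ (map (λ a → when (admissible≤? k a) (pow x a * M s (k ∸ a) xs)) (upTo (suc b)))
      ≈⟨ conv-bounded (λ j → M s j xs) x k≤b ⟨
    conv (λ j → M s j xs) x k ∎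

  boxSum≈M : ∀ {b k m} (xs : Vec Carrier m) → k ≤ b → boxSum b k xs ≈ M s k xs
  boxSum≈M []       k≤b = refl
  boxSum≈M (x ∷ xs) k≤b =
    trans (boxSum-∷-conv x xs k≤b (boxSum≈M xs)) (sym (boxSum-∷-conv x xs ≤-refl (boxSum≈M xs)))

  M-∷ : ∀ k {m} x (xs : Vec Carrier m) → M s k (x ∷ xs) ≈ conv (λ j → M s j xs) x k
  M-∷ k x xs = boxSum-∷-conv x xs ≤-refl (boxSum≈M xs)

  M-∷ʳ : ∀ k {m} (xs : Vec Carrier m) xn → M s k (xs ∷ʳ xn) ≈ conv (λ j → M s j xs) xn k
  M-∷ʳ k []       xn = M-∷ k xn []
  M-∷ʳ k (x ∷ xs) xn = begin
    M s k (x ∷ (xs ∷ʳ xn))               ≈⟨ M-∷ k x (xs ∷ʳ xn) ⟩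
    conv (λ j → M s j (xs ∷ʳ xn)) x k    ≈⟨ conv-cong x k (λ j → M-∷ʳ j xs xn) ⟩
    conv (conv (λ j → M s j xs) xn) x k  ≈⟨ conv-comm (λ j → M s j xs) x xn k ⟩
    conv (conv (λ j → M s j xs) x) xn k  ≈⟨ conv-cong xn k (λ j → M-∷ j x xs) ⟨
    conv (λ j → M s j (x ∷ xs)) xn k     ∎

theorem2p2 : ∀ {c ℓ : Level} (R : CommutativeRing c ℓ) →
    let open CommutativeRing R in
    let open ModSym R in
    (s : ℕ) → 1 ≤ s → (m : ℕ) → (xs : Vec Carrier m) → (xn : Carrier) →
    (k : ℕ) → suc s ≤ k →
    (M s k (xs ∷ʳ xn)
      ≈ Σ (map (λ j → pow xn j * M s (k ∸ j) xs) (filter (admissible? s) (upTo (suc k)))))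
    × (M s k (xs ∷ʳ xn)
      ≈ pow xn (suc s) * M s (k ∸ suc s) (xs ∷ʳ xn) + xn * M s (k ∸ 1) xs + M s k xs)
theorem2p2 R s 1≤s m xs xn k s<k = M-∷ʳ k xs xn , (begin
  M s k (xs ∷ʳ xn)
    ≈⟨ M-∷ʳ k xs xn ⟩
  conv F xn k
    ≈⟨ conv-recurrence 1≤s F xn s<k ⟩
  pow xn (suc s) * conv F xn (k ∸ suc s) + xn * F (k ∸ 1) + F k
    ≈⟨ +-congʳ (+-congʳ (*-congˡ (M-∷ʳ (k ∸ suc s) xs xn))) ⟨
  pow xn (suc s) * M s (k ∸ suc s) (xs ∷ʳ xn) + xn * F (k ∸ 1) + F k ∎)
  where
  open CommutativeRing R
  open ModSym R
  open Convolution R s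
  open Expansion R s
  open import Relation.Binary.Reasoning.Setoid setoid
  F : ℕ → Carrier
  F j = M s j xs
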